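{- Let $G$ be a finite simple graph containing a cycle $C$ formed by two vertices $u,v$ together with two vertex-disjoint (possibly empty) paths $P$ and $Q$, with $|V(P)|=3p$ and $|V(Q)|=3q$, such that $C$ consists of $u$, then $P$, then $v$, then $Q$, back to $u$ (so $uPv$ and $vQu$ are paths whose internal vertices are $V(P)$ and $V(Q)$), and every vertex of $C$ other than $u,v$ has degree exactly $2$ in $G$. Let $u'$ and $v'$ be the neighbours of $u$ and $v$ on the path $uPv$ respectively. Suppose $I$ is a minimum independent dominating set of $G$ with $u'\in I$. Then: (i) if $v\in I$, there is a minimum independent dominating set $I'$ of $G$ with $I'\setminus V(Q)=I\setminus V(Q)$ such that $I'\setminus V(P)$ dominates the graph $G-V(P)$ (where, if $V(P)=\varnothing$, $G-V(P)$ means $G$ with the edge $uv$ deleted); (ii) if $N(v)\cap I=\{v'\}$, there is a minimum independent dominating set $I'$ of $G$ containing $u'$ and $v$ such that $I'\setminus(V(P)\cup\{v\})=I\setminus(V(P)\cup\{v\})$.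
   Context: A set $A$ dominates a graph if every vertex is in $A$ or adjacent to a vertex of $A$; a minimum independent dominating set is an independent dominating set of minimum size. $N(v)$ is the set of neighbours of $v$. -}

module Defs where

open import Data.Nat using (ℕ; _≤_; _+_; _*_)
open import Data.Bool using (Bool; true; false; _∧_; _∨_; not; T; if_then_else_)
open import Data.Fin using (Fin; _≟_)
open import Data.Fin.Subset using (Subset; _∈_; _∉_; ⊥; ⁅_⁆; _∪_; _∩_; _─_; ∣_∣)
open import Data.Vec using (Vec; tabulate; toList)
open import Data.List using (List; []; _∷_; _++_; [_]; head; last)
open import Data.Maybe using (fromMaybe)
open import Data.Product using (Σ; ∃; _×_; _,_)
open import Data.Sum using (_⊎_)
open import Data.Empty using () renaming (⊥ to Empty)
open import Data.List.Relation.Unary.Linked using (Linked)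
open import Data.List.Relation.Unary.Unique.Propositional using (Unique)
open import Relation.Nullary.Decidable using (⌊_⌋)
open import Relation.Binary.PropositionalEquality using (_≡_)

record Graph (n : ℕ) : Set where
  field
    adj     : Fin n → Fin n → Bool
    adj-sym : ∀ x y → adj x y ≡ adj y x
    adj-irr : ∀ x → adj x x ≡ false
open Graph public

Adj : ∀ {n} → Graph n → Fin n → Fin n → Set
Adj G x y = T (adj G x y)

N : ∀ {n} → Graph n → Fin n → Subset n
N G v = tabulate (adj G v)

deg : ∀ {n} → Graph n → Fin n → ℕ
deg G v = ∣ N G v ∣

setOf : ∀ {n} → List (Fin n) → Subset n
setOf []       = ⊥
setOf (x ∷ xs) = ⁅ x ⁆ ∪ setOf xs

Independent : ∀ {n} → Graph n → Subset n → Set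
Independent G S = ∀ x y → x ∈ S → y ∈ S → ¬Adj x y
  where ¬Adj : _ → _ → Set
        ¬Adj x y = adj G x y ≡ false

Dominating : ∀ {n} → Graph n → Subset n → Set
Dominating G S = ∀ x → x ∈ S ⊎ (∃ λ y → y ∈ S × Adj G x y)

IndepDominating : ∀ {n} → Graph n → Subset n → Set
IndepDominating G S = Independent G S × Dominating G S

MinIndepDominating : ∀ {n} → Graph n → Subset n → Set
MinIndepDominating G S =
  IndepDominating G S × (∀ T → IndepDominating G T → ∣ S ∣ ≤ ∣ T ∣)

-- Domination of the graph with vertex set X and adjacency E restricted to X
-- (the induced subgraph on X of the graph with adjacency E).
-- D is required to be a set of vertices of that graph.
DominatesOn : ∀ {n} → (Fin n → Fin n → Bool) → Subset n → Subset n → Set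
DominatesOn E X D =
  (∀ x → x ∈ D → x ∈ X) ×
  (∀ x → x ∈ X → x ∈ D ⊎ (∃ λ y → y ∈ X × y ∈ D × T (E x y)))

deleteEdge : ∀ {n} → (Fin n → Fin n → Bool) → Fin n → Fin n → Fin n → Fin n → Bool
deleteEdge E u v x y =
  E x y ∧ not ((⌊ x ≟ u ⌋ ∧ ⌊ y ≟ v ⌋) ∨ (⌊ x ≟ v ⌋ ∧ ⌊ y ≟ u ⌋))

-- adjacency of the graph G - V(P), on the vertex set complement of V(P);
-- when P is empty this is G with the edge uv deleted.
adjMinusP : ∀ {n} → Graph n → Fin n → Fin n → List (Fin n) → Fin n → Fin n → Bool
adjMinusP G u v []      = deleteEdge (adj G) u v
adjMinusP G u v (_ ∷ _) = adj G

-- The cycle C = u P v Q u: all its vertices distinct, consecutive ones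
-- adjacent, and it has length at least 3.
IsCycleUPVQ : ∀ {n} → Graph n → Fin n → Fin n → List (Fin n) → List (Fin n) → Set
IsCycleUPVQ G u v Ps Qs =
  Unique (u ∷ v ∷ Ps ++ Qs) ×
  Linked (Adj G) (u ∷ Ps ++ v ∷ Qs ++ [ u ]) ×
  (Ps ≡ [] → Qs ≡ [] → Empty)

u′ : ∀ {n} → Fin n → Fin n → List (Fin n) → Fin n
u′ u v Ps = fromMaybe v (head Ps)

v′ : ∀ {n} → Fin n → Fin n → List (Fin n) → Fin n
v′ u v Ps = fromMaybe u (last Ps)

-- Both uPv and vQu are threads: paths whose interior vertices have no neighbours off
-- the path.  Cut a thread into consecutive triples.  A dominating set meets every
-- triple, since it must dominate the middle vertex; conversely, the last vertices of
-- the triples together with the vertex before the thread are independent and dominate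
-- it.  In (i) this lets I ∩ V(Q) be replaced by the last vertices of the triples of Q,
-- keeping I minimum: v ∈ I dominates the start of Q and the end of Q dominates u.  In
-- (ii) I ∩ (V(P) ∪ {v}) is replaced by v and the first vertices of the triples of P;
-- as u′, v′ ∈ I, the triples shifted by one vertex show that I has at least |P|/3 + 1
-- vertices on P, which pays for the extra vertex v.
module Submission where

open import Defs
open import Data.Nat using (ℕ; _*_)
open import Data.Fin using (Fin)
open import Data.Fin.Subset using (Subset; _∈_; _∉_; _∪_; _∩_; _─_; ⁅_⁆; ∁)
open import Data.Vec using (Vec; toList)
open import Data.Product using (∃; _×_)
open import Relation.Binary.PropositionalEquality using (_≡_)

open import Data.Nat using (zero; suc; _+_; _≤_; z≤n; s≤s)
open import Data.Nat.Properties using (≤-trans; ≤-reflexive; +-suc; +-comm; +-mono-≤; +-monoʳ-≤; n≤1+n; *-suc; suc-injective; module ≤-Reasoning)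
open import Data.Fin using (zero; suc; _≟_)
open import Data.Fin.Subset using (_⊆_; ∣_∣; inside; outside)
open import Data.Fin.Subset.Properties using (_∈?_; x∈p∪q⁺; x∈p∪q⁻; x∈p∩q⁺; x∈p∩q⁻; x∈p∧x∉q⇒x∈p─q; p─q⊆p; q⊆p∪q; p⊆q⇒∣p∣≤∣q∣; p⊂q⇒∣p∣<∣q∣; ⊆-antisym; x∈⁅x⁆; x∈⁅y⁆⇒x≡y; ∉⊥; x∉p⇒x∈∁p; x∈∁p⇒x∉p; ∣⁅x⁆∣≡1; ∣⊥∣≡0)
open import Data.Vec as Vec using ([]; _∷_)
open import Data.Vec.Properties using (lookup∘tabulate; lookup⇒[]=; []=⇒lookup; length-toList)
open import Data.List using (List; []; _∷_; _++_; length; last)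
open import Data.List.Relation.Unary.Any using (here; there)
open import Data.List.Relation.Unary.All using (All; []; _∷_)
open import Data.List.Relation.Unary.All.Properties using (All¬⇒¬Any; ++⁻ˡ; ++⁻ʳ)
open import Data.List.Relation.Unary.AllPairs using ([]; _∷_)
open import Data.List.Relation.Unary.Linked using (Linked; _∷_)
open import Data.List.Relation.Unary.Unique.Propositional using (Unique)
open import Data.List.Membership.Propositional using () renaming (_∈_ to _∈ₗ_; _∉_ to _∉ₗ_)
open import Data.List.Membership.Propositional.Properties using (∈-++⁺ˡ)
open import Data.List.Relation.Binary.Subset.Propositional using () renaming (_⊆_ to _⊆ₗ_)
open import Data.Bool using (Bool; true; false; T; not; _∧_; _∨_)
open import Data.Bool.Properties using (T-∧; T-≡)
open import Data.Maybe using (fromMaybe)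
open import Data.Sum using (_⊎_; inj₁; inj₂; [_,_]′; map₁; map₂)
open import Data.Product as Product using (_,_; proj₁; proj₂)
open import Data.Empty using (⊥-elim) renaming (⊥ to Empty)
open import Data.Unit using (tt)
open import Function using (_∘_)
open import Function.Bundles using (Equivalence)
open import Relation.Nullary using (¬_; yes; no)
open import Relation.Nullary.Decidable using (⌊_⌋)
open import Relation.Binary.PropositionalEquality using (_≢_; refl; sym; trans; cong; subst; ≢-sym)

x∈p─q⇒x∉q : ∀ {n} {x : Fin n} (p q : Subset n) → x ∈ p ─ q → x ∉ q
x∈p─q⇒x∉q (_ ∷ p) (outside ∷ q) Vec.here       ()
x∈p─q⇒x∉q (_ ∷ p) (_ ∷ q)       (Vec.there x∈) (Vec.there x∈q) = x∈p─q⇒x∉q p q x∈ x∈q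

∣p∣≡∣p∩q∣+∣p─q∣ : ∀ {n} (p q : Subset n) → ∣ p ∣ ≡ ∣ p ∩ q ∣ + ∣ p ─ q ∣
∣p∣≡∣p∩q∣+∣p─q∣ []           []           = refl
∣p∣≡∣p∩q∣+∣p─q∣ (inside ∷ p)  (inside ∷ q)  = cong suc (∣p∣≡∣p∩q∣+∣p─q∣ p q)
∣p∣≡∣p∩q∣+∣p─q∣ (inside ∷ p)  (outside ∷ q) = trans (cong suc (∣p∣≡∣p∩q∣+∣p─q∣ p q)) (sym (+-suc _ _))
∣p∣≡∣p∩q∣+∣p─q∣ (outside ∷ p) (inside ∷ q)  = ∣p∣≡∣p∩q∣+∣p─q∣ p q
∣p∣≡∣p∩q∣+∣p─q∣ (outside ∷ p) (outside ∷ q) = ∣p∣≡∣p∩q∣+∣p─q∣ p q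

∣p∪q∣≤∣p∣+∣q∣ : ∀ {n} (p q : Subset n) → ∣ p ∪ q ∣ ≤ ∣ p ∣ + ∣ q ∣
∣p∪q∣≤∣p∣+∣q∣ []           []           = z≤n
∣p∪q∣≤∣p∣+∣q∣ (inside ∷ p)  (inside ∷ q)  = s≤s (≤-trans (∣p∪q∣≤∣p∣+∣q∣ p q) (+-monoʳ-≤ ∣ p ∣ (n≤1+n _)))
∣p∪q∣≤∣p∣+∣q∣ (inside ∷ p)  (outside ∷ q) = s≤s (∣p∪q∣≤∣p∣+∣q∣ p q)
∣p∪q∣≤∣p∣+∣q∣ (outside ∷ p) (inside ∷ q)  = ≤-trans (s≤s (∣p∪q∣≤∣p∣+∣q∣ p q)) (≤-reflexive (sym (+-suc _ _)))
∣p∪q∣≤∣p∣+∣q∣ (outside ∷ p) (outside ∷ q) = ∣p∪q∣≤∣p∣+∣q∣ p q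

module _ {n : ℕ} {I A B : Subset n} where

  ∈-replace-kept : ∀ {x} → x ∈ I → x ∉ A → x ∈ (I ─ A) ∪ B
  ∈-replace-kept x∈I x∉A = x∈p∪q⁺ (inj₁ (x∈p∧x∉q⇒x∈p─q x∈I x∉A))

  ∈-replace-added : ∀ {x} → x ∈ B → x ∈ (I ─ A) ∪ B
  ∈-replace-added x∈B = x∈p∪q⁺ (inj₂ x∈B)

  replace-outside : B ⊆ A → ((I ─ A) ∪ B) ─ A ≡ I ─ A
  replace-outside B⊆A = ⊆-antisym shrink (λ x∈ → x∈p∧x∉q⇒x∈p─q (x∈p∪q⁺ (inj₁ x∈)) (x∈p─q⇒x∉q I A x∈))
    where
    shrink : ((I ─ A) ∪ B) ─ A ⊆ I ─ A
    shrink x∈ with x∈p∪q⁻ (I ─ A) B (p─q⊆p _ A x∈)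
    ... | inj₁ x∈I─A = x∈I─A
    ... | inj₂ x∈B   = ⊥-elim (x∈p─q⇒x∉q _ A x∈ (B⊆A x∈B))

All≢⇒∉ : ∀ {A : Set} {x : A} {xs} → All (x ≢_) xs → x ∉ₗ xs
All≢⇒∉ {x = x} = All¬⇒¬Any {P = x ≡_}

Unique-++⁻ : ∀ {A : Set} (xs : List A) {ys} → Unique (xs ++ ys) →
             Unique xs × Unique ys × (∀ {x} → x ∈ₗ xs → x ∉ₗ ys)
Unique-++⁻ []       u        = [] , u , λ ()
Unique-++⁻ (x ∷ xs) (x≢ ∷ u) with Unique-++⁻ xs u
... | uxs , uys , disjoint =
  (++⁻ˡ xs x≢ ∷ uxs) , uys , λ { (here refl) → All≢⇒∉ (++⁻ʳ xs x≢) ; (there x∈) → disjoint x∈ }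

linked-suffix : ∀ {A : Set} {R : A → A → Set} (xs : List A) {l r rest} →
                Linked R (l ∷ xs ++ r ∷ rest) → Linked R (r ∷ rest)
linked-suffix []       (_ ∷ linked) = linked
linked-suffix (_ ∷ xs) (_ ∷ linked) = linked-suffix xs linked

last-∈ : ∀ {A : Set} (d x : A) xs → fromMaybe d (last (x ∷ xs)) ∈ₗ x ∷ xs
last-∈ d x []       = here refl
last-∈ d x (y ∷ ys) = there (last-∈ d y ys)

data Triples {A : Set} : ℕ → List A → Set where
  []     : Triples 0 []
  triple : ∀ a b c {k xs} → Triples k xs → Triples (suc k) (a ∷ b ∷ c ∷ xs)

module _ {A : Set} where

  firsts thirds : ∀ {k xs} → Triples {A} k xs → List A
  firsts []               = []
  firsts (triple a _ _ t) = a ∷ firsts t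
  thirds []               = []
  thirds (triple _ _ c t) = c ∷ thirds t

  length-firsts : ∀ {k xs} (t : Triples {A} k xs) → length (firsts t) ≡ k
  length-firsts []               = refl
  length-firsts (triple _ _ _ t) = cong suc (length-firsts t)

  length-thirds : ∀ {k xs} (t : Triples {A} k xs) → length (thirds t) ≡ k
  length-thirds []               = refl
  length-thirds (triple _ _ _ t) = cong suc (length-thirds t)

  firsts⊆ : ∀ {k xs} (t : Triples {A} k xs) → firsts t ⊆ₗ xs
  firsts⊆ (triple _ _ _ t) (here refl) = here refl
  firsts⊆ (triple _ _ _ t) (there y∈)  = there (there (there (firsts⊆ t y∈)))

  thirds⊆ : ∀ {k xs} (t : Triples {A} k xs) → thirds t ⊆ₗ xs
  thirds⊆ (triple _ _ _ t) (here refl) = there (there (here refl))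
  thirds⊆ (triple _ _ _ t) (there y∈)  = there (there (there (thirds⊆ t y∈)))

  triples : ∀ k (xs : List A) → length xs ≡ 3 * k → Triples k xs
  triples zero    []      _ = []
  triples zero    (_ ∷ _) ()
  triples (suc k) xs      e = split xs (trans e (*-suc 3 k))
    where
    split : ∀ xs → length xs ≡ 3 + 3 * k → Triples (suc k) xs
    split (a ∷ b ∷ c ∷ xs) e = triple a b c (triples k xs (suc-injective (suc-injective (suc-injective e))))
    split []               ()
    split (_ ∷ [])         ()
    split (_ ∷ _ ∷ [])     ()

module _ {n : ℕ} where

  u′-cases : ∀ {y : Fin n} l r xs → y ≡ u′ l r xs → y ∈ₗ xs ⊎ y ≡ r
  u′-cases _ _ []       y≡r  = inj₂ y≡r
  u′-cases _ _ (x ∷ xs) refl = inj₁ (here refl)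

  u′∈firsts : ∀ {k xs} (l r : Fin n) (t : Triples k xs) → u′ l r xs ∈ₗ r ∷ firsts t
  u′∈firsts _ _ []               = here refl
  u′∈firsts _ _ (triple _ _ _ _) = there (here refl)

  setOf⁺ : ∀ {x : Fin n} {xs} → x ∈ₗ xs → x ∈ setOf xs
  setOf⁺ {xs = y ∷ _} (here refl) = x∈p∪q⁺ (inj₁ (x∈⁅x⁆ y))
  setOf⁺              (there x∈)  = x∈p∪q⁺ (inj₂ (setOf⁺ x∈))

  setOf⁻ : ∀ {x : Fin n} xs → x ∈ setOf xs → x ∈ₗ xs
  setOf⁻ []       x∈ = ⊥-elim (∉⊥ x∈)
  setOf⁻ (y ∷ ys) x∈ with x∈p∪q⁻ ⁅ y ⁆ (setOf ys) x∈
  ... | inj₁ x∈⁅y⁆ = here (x∈⁅y⁆⇒x≡y y x∈⁅y⁆)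
  ... | inj₂ x∈ys  = there (setOf⁻ ys x∈ys)

  ∣setOf∣≤length : ∀ (xs : List (Fin n)) → ∣ setOf xs ∣ ≤ length xs
  ∣setOf∣≤length []       = ≤-reflexive (∣⊥∣≡0 n)
  ∣setOf∣≤length (x ∷ xs) =
    ≤-trans (∣p∪q∣≤∣p∣+∣q∣ ⁅ x ⁆ (setOf xs)) (+-mono-≤ (≤-reflexive (∣⁅x⁆∣≡1 x)) (∣setOf∣≤length xs))

  ⊂-∷ : ∀ {x : Fin n} {xs} → x ∉ₗ xs → suc ∣ setOf xs ∣ ≤ ∣ setOf (x ∷ xs) ∣
  ⊂-∷ {x} {xs} x∉ = p⊂q⇒∣p∣<∣q∣ (q⊆p∪q ⁅ x ⁆ (setOf xs) , x , x∈p∪q⁺ (inj₁ (x∈⁅x⁆ x)) , x∉ ∘ setOf⁻ xs)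

  length≤∣setOf∣ : ∀ {xs : List (Fin n)} → Unique xs → length xs ≤ ∣ setOf xs ∣
  length≤∣setOf∣ []       = z≤n
  length≤∣setOf∣ (x≢ ∷ u) = ≤-trans (s≤s (length≤∣setOf∣ u)) (⊂-∷ (All≢⇒∉ x≢))

  ∩setOf-⊆ : ∀ (I : Subset n) {xs ys} → xs ⊆ₗ ys → I ∩ setOf xs ⊆ I ∩ setOf ys
  ∩setOf-⊆ I {xs} xs⊆ys z∈ with x∈p∩q⁻ I (setOf xs) z∈
  ... | z∈I , z∈xs = x∈p∩q⁺ (z∈I , setOf⁺ (xs⊆ys (setOf⁻ xs z∈xs)))

  ∣∩setOf∣-mono : ∀ (I : Subset n) xs ys → xs ⊆ₗ ys → ∣ I ∩ setOf xs ∣ ≤ ∣ I ∩ setOf ys ∣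
  ∣∩setOf∣-mono I _ _ = p⊆q⇒∣p∣≤∣q∣ ∘ ∩setOf-⊆ I

  ∣∩setOf∣-grow : ∀ (I : Subset n) {x} xs ys → x ∈ I → x ∈ₗ ys → x ∉ₗ xs → xs ⊆ₗ ys →
                  suc ∣ I ∩ setOf xs ∣ ≤ ∣ I ∩ setOf ys ∣
  ∣∩setOf∣-grow I {x} xs ys x∈I x∈ys x∉xs xs⊆ys =
    p⊂q⇒∣p∣<∣q∣ (∩setOf-⊆ I xs⊆ys , x , x∈p∩q⁺ (x∈I , setOf⁺ x∈ys) , x∉xs ∘ setOf⁻ xs ∘ proj₂ ∘ x∈p∩q⁻ I _)

deleteEdge⁺ : ∀ {n} (E : Fin n → Fin n → Bool) {u v x y} → T (E x y) →
              (x ≡ u → y ≢ v) → (x ≡ v → y ≢ u) → T (deleteEdge E u v x y)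
deleteEdge⁺ E {u} {v} {x} {y} xy h₁ h₂ = Equivalence.from (T-∧ {E x y}) (xy , not-uv)
  where
  not-uv : T (not ((⌊ x ≟ u ⌋ ∧ ⌊ y ≟ v ⌋) ∨ (⌊ x ≟ v ⌋ ∧ ⌊ y ≟ u ⌋)))
  not-uv with x ≟ u | y ≟ v | x ≟ v | y ≟ u
  ... | yes p | yes q | _     | _     = ⊥-elim (h₁ p q)
  ... | _     | _     | yes p | yes q = ⊥-elim (h₂ p q)
  ... | yes _ | no _  | yes _ | no _  = tt
  ... | yes _ | no _  | no _  | _     = tt
  ... | no _  | _     | yes _ | no _  = tt
  ... | no _  | _     | no _  | _     = tt

module _ {n : ℕ} (G : Graph n) where

  Adj-sym : ∀ {x y} → Adj G x y → Adj G y x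
  Adj-sym {x} {y} = subst T (adj-sym G x y)

  Adj-irrefl : ∀ {x} → ¬ Adj G x x
  Adj-irrefl {x} = subst T (adj-irr G x)

  Adj⇒∈N : ∀ {x y} → Adj G x y → y ∈ N G x
  Adj⇒∈N {x} {y} xy =
    lookup⇒[]= y (N G x) (trans (lookup∘tabulate (adj G x) y) (Equivalence.to T-≡ xy))

  ∈N⇒Adj : ∀ {x y} → y ∈ N G x → Adj G x y
  ∈N⇒Adj {x} {y} y∈ =
    Equivalence.from T-≡ (trans (sym (lookup∘tabulate (adj G x) y)) ([]=⇒lookup y∈))

  N∩≡⁅⁆⁻ : ∀ {v y I} → N G v ∩ I ≡ ⁅ y ⁆ → y ∈ I × Adj G v y × (∀ {x} → x ∈ I → Adj G v x → x ≡ y)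
  N∩≡⁅⁆⁻ {v} {y} {I} N∩I≡⁅y⁆ =
    proj₂ y∈N∩I , ∈N⇒Adj (proj₁ y∈N∩I) ,
    λ {x} x∈I vx → x∈⁅y⁆⇒x≡y y (subst (x ∈_) N∩I≡⁅y⁆ (x∈p∩q⁺ (Adj⇒∈N vx , x∈I)))
    where
    y∈N∩I = x∈p∩q⁻ (N G v) I (subst (y ∈_) (sym N∩I≡⁅y⁆) (x∈⁅x⁆ y))

  Independent⇒¬Adj : ∀ {S x y} → Independent G S → x ∈ S → y ∈ S → ¬ Adj G x y
  Independent⇒¬Adj indS x∈S y∈S = subst T (indS _ _ x∈S y∈S)

  independent : ∀ {S} → (∀ {x y} → x ∈ S → y ∈ S → ¬ Adj G x y) → Independent G S
  independent nonadj x y x∈S y∈S with adj G x y | nonadj x∈S y∈S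
  ... | true  | ¬xy = ⊥-elim (¬xy tt)
  ... | false | _   = refl

  DominatedBy : Subset n → Fin n → Set
  DominatedBy S x = x ∈ S ⊎ ∃ λ y → y ∈ S × Adj G x y

  Neighbours⊆ : Fin n → Fin n → Fin n → Set
  Neighbours⊆ x a b = ∀ {y} → Adj G x y → y ≡ a ⊎ y ≡ b

  deg≡2⇒Neighbours⊆ : ∀ {x a b} → deg G x ≡ 2 → Adj G x a → Adj G x b → a ≢ b → Neighbours⊆ x a b
  deg≡2⇒Neighbours⊆ {x} {a} {b} deg≡2 xa xb a≢b {y} xy with y ≟ a | y ≟ b
  ... | yes y≡a | _       = inj₁ y≡a
  ... | no _    | yes y≡b = inj₂ y≡b
  ... | no y≢a  | no y≢b  =
    ⊥-elim (3≰2 (subst (3 ≤_) deg≡2 (≤-trans (length≤∣setOf∣ distinct) (p⊆q⇒∣p∣≤∣q∣ ⊆N))))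
    where
    3≰2 : ¬ 3 ≤ 2
    3≰2 (s≤s (s≤s ()))
    distinct : Unique (a ∷ b ∷ y ∷ [])
    distinct = (a≢b ∷ y≢a ∘ sym ∷ []) ∷ (y≢b ∘ sym ∷ []) ∷ [] ∷ []
    ⊆N : setOf (a ∷ b ∷ y ∷ []) ⊆ N G x
    ⊆N z∈ with setOf⁻ (a ∷ b ∷ y ∷ []) z∈
    ... | here refl                 = Adj⇒∈N xa
    ... | there (here refl)         = Adj⇒∈N xb
    ... | there (there (here refl)) = Adj⇒∈N xy

  adjMinusP⁺ : ∀ {u v} Ps {x y} → Adj G x y → (x ≡ u → y ≢ v) → (x ≡ v → y ≢ u) →
               T (adjMinusP G u v Ps x y)
  adjMinusP⁺ []      xy h₁ h₂ = deleteEdge⁺ (adj G) xy h₁ h₂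
  adjMinusP⁺ (_ ∷ _) xy _  _  = xy

  adjMinusP-∷ : ∀ {u v Ps x y} → (Ps ≡ [] → Empty) → Adj G x y → T (adjMinusP G u v Ps x y)
  adjMinusP-∷ {Ps = []}    Ps≢[] _  = ⊥-elim (Ps≢[] refl)
  adjMinusP-∷ {Ps = _ ∷ _} _     xy = xy

  adjMinusP⇒Adj : ∀ {u v} Ps {x y} → T (adjMinusP G u v Ps x y) → Adj G x y
  adjMinusP⇒Adj []      xy = proj₁ (Equivalence.to T-∧ xy)
  adjMinusP⇒Adj (_ ∷ _) xy = xy

  data Thread (l : Fin n) : List (Fin n) → Fin n → Set where
    edge : ∀ {r} → Adj G l r → Thread l [] r
    step : ∀ {x xs r} → Adj G l x → Neighbours⊆ x l (u′ x r xs) → Thread x xs r → Thread l (x ∷ xs) r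

  Adj-u′ : ∀ {l xs r} → Thread l xs r → Adj G l (u′ l r xs)
  Adj-u′ (edge lr)     = lr
  Adj-u′ (step lx _ _) = lx

  linked⇒thread : ∀ {l r} xs {rest} → Linked (Adj G) (l ∷ xs ++ r ∷ rest) → Unique (l ∷ r ∷ xs) →
                  (∀ {w} → w ∈ₗ xs → deg G w ≡ 2) → Thread l xs r
  linked⇒thread []       (lr ∷ _) _ _ = edge lr
  linked⇒thread {l} {r} (x ∷ xs) (lx ∷ linked) ((l≢r ∷ _ ∷ l≢xs) ∷ (r≢x ∷ r≢xs) ∷ (x≢xs ∷ uxs)) deg≡2 =
    step lx (deg≡2⇒Neighbours⊆ (deg≡2 (here refl)) (Adj-sym lx) (Adj-u′ thread) l≢u′) thread
    where
    thread : Thread x xs r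
    thread = linked⇒thread xs linked ((≢-sym r≢x ∷ x≢xs) ∷ r≢xs ∷ uxs) (deg≡2 ∘ there)
    l≢u′ : l ≢ u′ x r xs
    l≢u′ = [ All≢⇒∉ l≢xs , l≢r ]′ ∘ u′-cases x r xs

  thread-neighbour : ∀ {l xs r y x} → Thread l xs r → y ∈ₗ xs → Adj G y x → x ≡ l ⊎ x ∈ₗ xs ⊎ x ≡ r
  thread-neighbour {xs = y ∷ xs} {r} (step _ nb _) (here refl) yx with nb yx
  ... | inj₁ x≡l  = inj₁ x≡l
  ... | inj₂ x≡u′ = inj₂ (map₁ there (u′-cases y r xs x≡u′))
  thread-neighbour (step _ _ thread) (there y∈) yx with thread-neighbour thread y∈ yx
  ... | inj₁ refl = inj₂ (inj₁ (here refl))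
  ... | inj₂ x∈   = inj₂ (map₁ there x∈)

  firsts-neighbour : ∀ {l xs r k y x} → Thread l xs r → (t : Triples k xs) → y ∈ₗ firsts t → Adj G y x →
                     x ≡ l ⊎ x ∈ₗ xs
  firsts-neighbour (step _ nb _) (triple _ _ _ _) (here refl) yx =
    map₂ (λ { refl → there (here refl) }) (nb yx)
  firsts-neighbour (step _ _ (step _ _ (step _ _ thread))) (triple _ _ _ t) (there y∈) yx =
    inj₂ ([ (λ { refl → there (there (here refl)) }) , there ∘ there ∘ there ]′ (firsts-neighbour thread t y∈ yx))

  thirds-neighbour : ∀ {l xs r k y x} → Thread l xs r → (t : Triples k xs) → y ∈ₗ thirds t → Adj G y x →
                     x ∈ₗ xs ⊎ x ≡ r
  thirds-neighbour {r = r} (step _ _ (step _ _ (step _ nb _))) (triple _ _ c {xs = rest} _) (here refl) yx =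
    [ (λ { refl → inj₁ (there (here refl)) }) , map₁ (there ∘ there ∘ there) ∘ u′-cases c r rest ]′ (nb yx)
  thirds-neighbour (step _ _ (step _ _ (step _ _ thread))) (triple _ _ _ t) (there y∈) yx =
    map₁ (there ∘ there ∘ there) (thirds-neighbour thread t y∈ yx)

  firsts-independent : ∀ {l xs r k} → Thread l xs r → (t : Triples k xs) → Unique xs →
                       ∀ {y z} → y ∈ₗ firsts t → z ∈ₗ firsts t → ¬ Adj G y z
  firsts-independent (step _ _ (step _ _ (step _ _ thread))) (triple a b c t) ((_ ∷ a≢) ∷ _ ∷ _ ∷ u) = nonadj
    where
    a-nonadj : ∀ {z} → z ∈ₗ firsts t → ¬ Adj G a z
    a-nonadj z∈ az = All≢⇒∉ a≢ ([ here , there ]′ (firsts-neighbour thread t z∈ (Adj-sym az)))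
    nonadj : ∀ {y z} → y ∈ₗ firsts (triple a b c t) → z ∈ₗ firsts (triple a b c t) → ¬ Adj G y z
    nonadj (here refl) (here refl) = Adj-irrefl
    nonadj (here refl) (there z∈)  = a-nonadj z∈
    nonadj (there y∈)  (here refl) = a-nonadj y∈ ∘ Adj-sym
    nonadj (there y∈)  (there z∈)  = firsts-independent thread t u y∈ z∈

  end∷firsts-independent : ∀ {l xs r k} → Thread l xs r → (t : Triples k xs) → l ≢ r → r ∉ₗ xs → Unique xs →
                           ∀ {y z} → y ∈ₗ r ∷ firsts t → z ∈ₗ r ∷ firsts t → ¬ Adj G y z
  end∷firsts-independent {r = r} thread t l≢r r∉ u = nonadj
    where
    r-nonadj : ∀ {z} → z ∈ₗ firsts t → ¬ Adj G r z
    r-nonadj z∈ rz = [ l≢r ∘ sym , r∉ ]′ (firsts-neighbour thread t z∈ (Adj-sym rz))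
    nonadj : ∀ {y z} → y ∈ₗ r ∷ firsts t → z ∈ₗ r ∷ firsts t → ¬ Adj G y z
    nonadj (here refl) (here refl) = Adj-irrefl
    nonadj (here refl) (there z∈)  = r-nonadj z∈
    nonadj (there y∈)  (here refl) = r-nonadj y∈ ∘ Adj-sym
    nonadj (there y∈)  (there z∈)  = firsts-independent thread t u y∈ z∈

  thirds-independent : ∀ {l xs r k} → Thread l xs r → (t : Triples k xs) → Unique xs → r ∉ₗ xs →
                       ∀ {y z} → y ∈ₗ thirds t → z ∈ₗ thirds t → ¬ Adj G y z
  thirds-independent (step _ _ (step _ _ (step _ _ thread))) (triple a b c t) (_ ∷ _ ∷ c≢ ∷ u) r∉ = nonadj
    where
    c-nonadj : ∀ {z} → z ∈ₗ thirds t → ¬ Adj G c z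
    c-nonadj z∈ cz with thirds-neighbour thread t z∈ (Adj-sym cz)
    ... | inj₁ c∈  = All≢⇒∉ c≢ c∈
    ... | inj₂ refl = r∉ (there (there (here refl)))
    nonadj : ∀ {y z} → y ∈ₗ thirds (triple a b c t) → z ∈ₗ thirds (triple a b c t) → ¬ Adj G y z
    nonadj (here refl) (here refl) = Adj-irrefl
    nonadj (here refl) (there z∈)  = c-nonadj z∈
    nonadj (there y∈)  (here refl) = c-nonadj y∈ ∘ Adj-sym
    nonadj (there y∈)  (there z∈)  = thirds-independent thread t u (r∉ ∘ there ∘ there ∘ there) y∈ z∈

  firsts-dominate : ∀ {l xs r k S} → Thread l xs r → (t : Triples k xs) → (∀ {y} → y ∈ₗ r ∷ firsts t → y ∈ S) →
                    ∀ {x} → x ∈ₗ xs → DominatedBy S x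
  firsts-dominate _ (triple _ _ _ _) ⊆S (here refl) = inj₁ (⊆S (there (here refl)))
  firsts-dominate (step _ _ (step ab _ _)) (triple a _ _ _) ⊆S (there (here refl)) =
    inj₂ (a , ⊆S (there (here refl)) , Adj-sym ab)
  firsts-dominate {r = r} {S = S} (step _ _ (step _ _ (step _ _ thread))) (triple _ _ c {xs = rest} t) ⊆S (there (there x∈)) =
    dominate x∈
    where
    ⊆S′ : ∀ {y} → y ∈ₗ r ∷ firsts t → y ∈ S
    ⊆S′ (here refl) = ⊆S (here refl)
    ⊆S′ (there y∈)  = ⊆S (there (there y∈))
    dominate : ∀ {x} → x ∈ₗ c ∷ rest → DominatedBy S x
    dominate (here refl) = inj₂ (_ , ⊆S′ (u′∈firsts c r t) , Adj-u′ thread)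
    dominate (there x∈)  = firsts-dominate thread t ⊆S′ x∈

  thirds-dominate : ∀ {l xs r k S} → Thread l xs r → (t : Triples k xs) → (∀ {y} → y ∈ₗ l ∷ thirds t → y ∈ S) →
                    ∀ {x} → x ∈ₗ xs → DominatedBy S x
  thirds-dominate (step la _ _) (triple _ _ _ _) ⊆S (here refl) = inj₂ (_ , ⊆S (here refl) , Adj-sym la)
  thirds-dominate (step _ _ (step _ _ (step bc _ _))) (triple _ _ c _) ⊆S (there (here refl)) =
    inj₂ (c , ⊆S (there (here refl)) , bc)
  thirds-dominate _ (triple _ _ _ _) ⊆S (there (there (here refl))) = inj₁ (⊆S (there (here refl)))
  thirds-dominate (step _ _ (step _ _ (step _ _ thread))) (triple _ _ _ t) ⊆S (there (there (there x∈))) =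
    thirds-dominate thread t (⊆S ∘ there) x∈

  thirds-end : ∀ {l xs r k} → Thread l xs r → (t : Triples (suc k) xs) → ∃ λ y → y ∈ₗ thirds t × Adj G r y
  thirds-end {r = r} (step _ _ (step _ _ (step _ _ thread))) (triple _ _ _ t) = end thread t
    where
    end : ∀ {l xs k} → Thread l xs r → (t : Triples k xs) → ∃ λ y → y ∈ₗ l ∷ thirds t × Adj G r y
    end (edge lr) [] = _ , here refl , Adj-sym lr
    end (step _ _ (step _ _ (step _ _ thread))) (triple _ _ _ t) with end thread t
    ... | y , y∈ , ry = y , there y∈ , ry

  dominating-meets : ∀ {I x a b} → Dominating G I → Neighbours⊆ x a b → ∃ λ w → w ∈ₗ a ∷ x ∷ b ∷ [] × w ∈ I
  dominating-meets {x = x} domI nb with domI x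
  ... | inj₁ x∈I            = x , there (here refl) , x∈I
  ... | inj₂ (y , y∈I , xy) with nb xy
  ...   | inj₁ refl = y , here refl , y∈I
  ...   | inj₂ refl = y , there (there (here refl)) , y∈I

  count-triples : ∀ {l xs r k I} → Thread l xs r → (t : Triples k xs) → Unique xs → Dominating G I →
                  k ≤ ∣ I ∩ setOf xs ∣
  count-triples _ [] _ _ = z≤n
  count-triples {I = I} (step _ _ (step _ nb (step _ _ thread))) (triple a b c t) u domI
    with Unique-++⁻ (a ∷ b ∷ c ∷ []) u | dominating-meets domI nb
  ... | _ , u-rest , disjoint | w , w∈abc , w∈I =
    ≤-trans (s≤s (count-triples thread t u-rest domI))
            (∣∩setOf∣-grow I _ (a ∷ b ∷ c ∷ _) w∈I (∈-++⁺ˡ w∈abc) (disjoint w∈abc) (there ∘ there ∘ there))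

  -- If I contains both end vertices of xs, shift the triples by one vertex: then
  -- the first vertex, the last two and each of the k − 1 triples in between are hit.
  count-triples-ends : ∀ {l xs r k I} d → Thread l xs r → (t : Triples (suc k) xs) → Unique xs →
                       Dominating G I → u′ l r xs ∈ I → fromMaybe d (last xs) ∈ I →
                       suc (suc k) ≤ ∣ I ∩ setOf xs ∣
  count-triples-ends {I = I} _ _ (triple a b c []) ((_ ∷ a≢c ∷ []) ∷ _) _ a∈I c∈I =
    ≤-trans (s≤s (≤-trans (s≤s z≤n) (∣∩setOf∣-grow I [] (c ∷ []) c∈I (here refl) (λ ()) (λ ()))))
            (∣∩setOf∣-grow I (c ∷ []) (a ∷ b ∷ c ∷ []) a∈I (here refl) (All≢⇒∉ (a≢c ∷ [])) (there ∘ there))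
  count-triples-ends {k = k} {I} d (step _ _ (step _ _ (step _ nc thread))) (triple a b c {xs = rest} t@(triple _ _ _ _))
                     (a≢ ∷ (_ ∷ b≢) ∷ c≢ ∷ u) domI a∈I last∈I =
    ≤-trans (s≤s after-a) (∣∩setOf∣-grow I (b ∷ c ∷ rest) (a ∷ b ∷ c ∷ rest) a∈I (here refl) (All≢⇒∉ a≢) there)
    where
    with-rest : ∀ {w} → w ∈ I → w ∈ₗ b ∷ c ∷ rest → w ∉ₗ rest → suc k ≤ ∣ I ∩ setOf (b ∷ c ∷ rest) ∣
    with-rest w∈I w∈ w∉rest =
      ≤-trans (s≤s (count-triples thread t u domI)) (∣∩setOf∣-grow I rest (b ∷ c ∷ rest) w∈I w∈ w∉rest (there ∘ there))
    after-a : suc k ≤ ∣ I ∩ setOf (b ∷ c ∷ rest) ∣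
    after-a with b ∈? I | c ∈? I
    ... | yes b∈I | _       = with-rest b∈I (here refl) (All≢⇒∉ b≢)
    ... | no _    | yes c∈I = with-rest c∈I (there (here refl)) (All≢⇒∉ c≢)
    ... | no b∉I  | no c∉I with domI c
    ...   | inj₁ c∈I            = ⊥-elim (c∉I c∈I)
    ...   | inj₂ (y , y∈I , cy) with nc cy
    ...     | inj₁ refl = ⊥-elim (b∉I y∈I)
    ...     | inj₂ refl = ≤-trans (count-triples-ends d thread t u domI y∈I last∈I)
                                  (∣∩setOf∣-mono I rest (b ∷ c ∷ rest) (there ∘ there))

  -- Only vertices of A, and vertices whose I-neighbour lay in A, can lose their domination.
  replace-minIndepDominating :
    ∀ {I A B} → MinIndepDominating G I → Independent G B →
    (∀ {x y} → x ∈ I → x ∉ A → y ∈ B → ¬ Adj G x y) →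
    (∀ {x} → x ∈ A ⊎ (∃ λ y → y ∈ I × y ∈ A × Adj G x y) → DominatedBy ((I ─ A) ∪ B) x) →
    ∣ B ∣ ≤ ∣ I ∩ A ∣ → MinIndepDominating G ((I ─ A) ∪ B)
  replace-minIndepDominating {I} {A} {B} ((indI , domI) , minI) indB cross dom-near ∣B∣≤ =
    (independent nonadj , dom) , λ S S-ids → ≤-trans ∣J∣≤∣I∣ (minI S S-ids)
    where
    nonadj : ∀ {x y} → x ∈ (I ─ A) ∪ B → y ∈ (I ─ A) ∪ B → ¬ Adj G x y
    nonadj x∈ y∈ with x∈p∪q⁻ (I ─ A) B x∈ | x∈p∪q⁻ (I ─ A) B y∈
    ... | inj₁ x∈I─A | inj₁ y∈I─A = Independent⇒¬Adj indI (p─q⊆p I A x∈I─A) (p─q⊆p I A y∈I─A)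
    ... | inj₁ x∈I─A | inj₂ y∈B   = cross (p─q⊆p I A x∈I─A) (x∈p─q⇒x∉q I A x∈I─A) y∈B
    ... | inj₂ x∈B   | inj₁ y∈I─A = cross (p─q⊆p I A y∈I─A) (x∈p─q⇒x∉q I A y∈I─A) x∈B ∘ Adj-sym
    ... | inj₂ x∈B   | inj₂ y∈B   = Independent⇒¬Adj indB x∈B y∈B
    dom : Dominating G ((I ─ A) ∪ B)
    dom x with x ∈? A | x ∈? I
    ... | yes x∈A | _       = dom-near (inj₁ x∈A)
    ... | no x∉A  | yes x∈I = inj₁ (∈-replace-kept x∈I x∉A)
    ... | no x∉A  | no x∉I with domI x
    ...   | inj₁ x∈I            = ⊥-elim (x∉I x∈I)
    ...   | inj₂ (y , y∈I , xy) with y ∈? A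
    ...     | yes y∈A = dom-near (inj₂ (y , y∈I , y∈A , xy))
    ...     | no y∉A  = inj₂ (y , ∈-replace-kept y∈I y∉A , xy)
    open ≤-Reasoning
    ∣J∣≤∣I∣ : ∣ (I ─ A) ∪ B ∣ ≤ ∣ I ∣
    ∣J∣≤∣I∣ = begin
      ∣ (I ─ A) ∪ B ∣         ≤⟨ ∣p∪q∣≤∣p∣+∣q∣ (I ─ A) B ⟩
      ∣ I ─ A ∣ + ∣ B ∣       ≤⟨ +-monoʳ-≤ ∣ I ─ A ∣ ∣B∣≤ ⟩
      ∣ I ─ A ∣ + ∣ I ∩ A ∣   ≡⟨ +-comm ∣ I ─ A ∣ ∣ I ∩ A ∣ ⟩
      ∣ I ∩ A ∣ + ∣ I ─ A ∣   ≡⟨ ∣p∣≡∣p∩q∣+∣p─q∣ I A ⟨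
      ∣ I ∣                   ∎

  dominatesOn-G-P : ∀ {u v Ps J} → Thread u Ps v → Dominating G J → v ∈ J →
                    (∃ λ y → y ∈ J × y ∉ setOf Ps × T (adjMinusP G u v Ps u y)) →
                    DominatesOn (adjMinusP G u v Ps) (∁ (setOf Ps)) (J ─ setOf Ps)
  dominatesOn-G-P {u} {v} {Ps} {J} thread domJ v∈J (y₀ , y₀∈J , y₀∉P , uy₀) =
    (λ x x∈ → x∉p⇒x∈∁p (x∈p─q⇒x∉q J (setOf Ps) x∈)) , dom
    where
    dom : ∀ x → x ∈ ∁ (setOf Ps) → x ∈ J ─ setOf Ps ⊎
          ∃ λ y → y ∈ ∁ (setOf Ps) × y ∈ J ─ setOf Ps × T (adjMinusP G u v Ps x y)
    dom x x∈∁P with x ≟ u | x ∈? J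
    ... | yes refl | _       = inj₂ (y₀ , x∉p⇒x∈∁p y₀∉P , x∈p∧x∉q⇒x∈p─q y₀∈J y₀∉P , uy₀)
    ... | no _     | yes x∈J = inj₁ (x∈p∧x∉q⇒x∈p─q x∈J (x∈∁p⇒x∉p x∈∁P))
    ... | no x≢u   | no x∉J with domJ x
    ...   | inj₁ x∈J            = ⊥-elim (x∉J x∈J)
    ...   | inj₂ (y , y∈J , xy) with y ∈? setOf Ps
    ...     | no y∉P  = inj₂ (y , x∉p⇒x∈∁p y∉P , x∈p∧x∉q⇒x∈p─q y∈J y∉P ,
                              adjMinusP⁺ Ps xy (⊥-elim ∘ x≢u) (λ { refl → ⊥-elim (x∉J v∈J) }))
    ...     | yes y∈P with thread-neighbour thread (setOf⁻ Ps y∈P) (Adj-sym xy)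
    ...       | inj₁ x≡u          = ⊥-elim (x≢u x≡u)
    ...       | inj₂ (inj₁ x∈P)   = ⊥-elim (x∈∁p⇒x∉p x∈∁P (setOf⁺ x∈P))
    ...       | inj₂ (inj₂ refl)  = ⊥-elim (x∉J v∈J)

  record Cycle (u v : Fin n) (Ps Qs : List (Fin n)) : Set where
    field
      thread-P : Thread u Ps v
      thread-Q : Thread v Qs u
      unique-P : Unique Ps
      unique-Q : Unique Qs
      u≢v      : u ≢ v
      v∉P      : v ∉ₗ Ps
      u∉Q      : u ∉ₗ Qs
      v∉Q      : v ∉ₗ Qs
      P∩Q≡∅    : ∀ {x} → x ∈ₗ Ps → x ∉ₗ Qs
      nonempty : Ps ≡ [] → Qs ≡ [] → Empty

  toCycle : ∀ {u v Ps Qs} → IsCycleUPVQ G u v Ps Qs →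
            (∀ w → w ∈ setOf Ps ∪ setOf Qs → deg G w ≡ 2) → Cycle u v Ps Qs
  toCycle {Ps = Ps} ((u≢v ∷ u≢PQ) ∷ v≢PQ ∷ unique-PQ , linked , nonempty) deg≡2
    with Unique-++⁻ Ps unique-PQ
  ... | unique-P , unique-Q , P∩Q≡∅ = record
    { thread-P = linked⇒thread Ps linked ((u≢v ∷ ++⁻ˡ Ps u≢PQ) ∷ ++⁻ˡ Ps v≢PQ ∷ unique-P)
                   (λ w∈ → deg≡2 _ (x∈p∪q⁺ (inj₁ (setOf⁺ w∈))))
    ; thread-Q = linked⇒thread _ (linked-suffix Ps linked) ((≢-sym u≢v ∷ ++⁻ʳ Ps v≢PQ) ∷ ++⁻ʳ Ps u≢PQ ∷ unique-Q)
                   (λ w∈ → deg≡2 _ (x∈p∪q⁺ (inj₂ (setOf⁺ w∈))))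
    ; unique-P = unique-P
    ; unique-Q = unique-Q
    ; u≢v      = u≢v
    ; v∉P      = All≢⇒∉ (++⁻ˡ Ps v≢PQ)
    ; u∉Q      = All≢⇒∉ (++⁻ʳ Ps u≢PQ)
    ; v∉Q      = All≢⇒∉ (++⁻ʳ Ps v≢PQ)
    ; P∩Q≡∅    = P∩Q≡∅
    ; nonempty = nonempty
    }

  u-neighbour-in-G-P : ∀ {u v Ps Qs k} → Cycle u v Ps Qs → (t : Triples k Qs) →
                       ∃ λ y → y ∈ₗ v ∷ thirds t × y ∉ₗ Ps × T (adjMinusP G u v Ps u y)
  u-neighbour-in-G-P C [] =
    _ , here refl , v∉P , adjMinusP-∷ (λ P≡[] → nonempty P≡[] refl) (Adj-sym (Adj-u′ thread-Q))
    where open Cycle C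
  u-neighbour-in-G-P {Ps = Ps} {Qs} C t@(triple _ _ _ _) with thirds-end (Cycle.thread-Q C) t
  ... | y , y∈ , uy =
    y , there y∈ , (λ y∈P → P∩Q≡∅ y∈P y∈Q) ,
    adjMinusP⁺ Ps uy (λ _ y≡v → v∉Q (subst (_∈ₗ Qs) y≡v y∈Q)) (⊥-elim ∘ u≢v)
    where
    open Cycle C
    y∈Q : y ∈ₗ Qs
    y∈Q = thirds⊆ t y∈

  part-i : ∀ {u v Ps Qs k I} → Cycle u v Ps Qs → Triples k Qs → MinIndepDominating G I →
           u′ u v Ps ∈ I → v ∈ I →
           ∃ λ I′ → MinIndepDominating G I′ × (I′ ─ setOf Qs ≡ I ─ setOf Qs) ×
                    DominatesOn (adjMinusP G u v Ps) (∁ (setOf Ps)) (I′ ─ setOf Ps)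
  part-i {u} {v} {Ps} {Qs} {I = I} C t minI@((indI , domI) , _) u′∈I v∈I with u-neighbour-in-G-P C t
  ... | y₀ , y₀∈ , y₀∉P , uy₀ =
    I′ , minI′ , replace-outside (setOf⁺ ∘ thirds⊆ t ∘ setOf⁻ (thirds t)) ,
    dominatesOn-G-P thread-P (proj₂ (proj₁ minI′)) v∈I′ (y₀ , v∷thirds⊆I′ y₀∈ , y₀∉P ∘ setOf⁻ Ps , uy₀)
    where
    open Cycle C
    A B I′ : Subset n
    A  = setOf Qs
    B  = setOf (thirds t)
    I′ = (I ─ A) ∪ B
    u∉I : u ∉ I
    u∉I u∈I = Independent⇒¬Adj indI u∈I u′∈I (Adj-u′ thread-P)
    v∈I′ : v ∈ I′
    v∈I′ = ∈-replace-kept v∈I (v∉Q ∘ setOf⁻ Qs)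
    v∷thirds⊆I′ : ∀ {y} → y ∈ₗ v ∷ thirds t → y ∈ I′
    v∷thirds⊆I′ (here refl) = v∈I′
    v∷thirds⊆I′ (there y∈)  = ∈-replace-added (setOf⁺ y∈)
    cross : ∀ {x y} → x ∈ I → x ∉ A → y ∈ B → ¬ Adj G x y
    cross x∈I x∉A y∈B xy with thirds-neighbour thread-Q t (setOf⁻ _ y∈B) (Adj-sym xy)
    ... | inj₁ x∈Q  = x∉A (setOf⁺ x∈Q)
    ... | inj₂ refl = u∉I x∈I
    dom-near : ∀ {x} → x ∈ A ⊎ (∃ λ y → y ∈ I × y ∈ A × Adj G x y) → DominatedBy I′ x
    dom-near (inj₁ x∈Q) = thirds-dominate thread-Q t v∷thirds⊆I′ (setOf⁻ Qs x∈Q)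
    dom-near (inj₂ (y , _ , y∈Q , xy)) with thread-neighbour thread-Q (setOf⁻ Qs y∈Q) (Adj-sym xy)
    ... | inj₁ refl        = inj₁ v∈I′
    ... | inj₂ (inj₁ x∈Q)  = thirds-dominate thread-Q t v∷thirds⊆I′ x∈Q
    ... | inj₂ (inj₂ refl) = inj₂ (y₀ , v∷thirds⊆I′ y₀∈ , adjMinusP⇒Adj Ps uy₀)
    count : ∣ B ∣ ≤ ∣ I ∩ A ∣
    count = ≤-trans (∣setOf∣≤length (thirds t))
                    (subst (_≤ ∣ I ∩ A ∣) (sym (length-thirds t)) (count-triples thread-Q t unique-Q domI))
    minI′ : MinIndepDominating G I′
    minI′ = replace-minIndepDominating minI
      (independent λ y∈ z∈ → thirds-independent thread-Q t unique-Q u∉Q (setOf⁻ _ y∈) (setOf⁻ _ z∈))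
      cross dom-near count

  part-ii : ∀ {u v Ps Qs k I} → Cycle u v Ps Qs → Triples k Ps → MinIndepDominating G I →
            u′ u v Ps ∈ I → N G v ∩ I ≡ ⁅ v′ u v Ps ⁆ →
            ∃ λ I′ → MinIndepDominating G I′ × u′ u v Ps ∈ I′ × v ∈ I′ ×
                     (I′ ─ (setOf Ps ∪ ⁅ v ⁆) ≡ I ─ (setOf Ps ∪ ⁅ v ⁆))
  -- With P empty, u′ = v and v′ = u: two adjacent vertices of I.
  part-ii C [] ((indI , _) , _) v∈I N∩I≡⁅u⁆ =
    ⊥-elim (Independent⇒¬Adj indI (proj₁ (N∩≡⁅⁆⁻ N∩I≡⁅u⁆)) v∈I (Adj-u′ (Cycle.thread-P C)))
  part-ii {u} {v} {Ps} {k = suc k} {I} C t@(triple a _ _ _) minI@((indI , domI) , _) a∈I N∩I≡⁅v′⁆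
    with N∩≡⁅⁆⁻ N∩I≡⁅v′⁆
  ... | v′∈I , v-v′ , I-neighbour-of-v =
    I′ , minI′ , v∷firsts⊆I′ (there (here refl)) , v∷firsts⊆I′ (here refl) , replace-outside B⊆A
    where
    open Cycle C
    A B I′ : Subset n
    A  = setOf Ps ∪ ⁅ v ⁆
    B  = setOf (v ∷ firsts t)
    I′ = (I ─ A) ∪ B
    v∉I : v ∉ I
    v∉I v∈I = Independent⇒¬Adj indI v∈I v′∈I v-v′
    u∉I : u ∉ I
    u∉I u∈I = Independent⇒¬Adj indI u∈I a∈I (Adj-u′ thread-P)
    P⊆A : ∀ {x} → x ∈ₗ Ps → x ∈ A
    P⊆A = x∈p∪q⁺ ∘ inj₁ ∘ setOf⁺
    v∷firsts⊆A : ∀ {x} → x ∈ₗ v ∷ firsts t → x ∈ A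
    v∷firsts⊆A (here refl) = x∈p∪q⁺ (inj₂ (x∈⁅x⁆ v))
    v∷firsts⊆A (there x∈)  = P⊆A (firsts⊆ t x∈)
    B⊆A : B ⊆ A
    B⊆A = v∷firsts⊆A ∘ setOf⁻ (v ∷ firsts t)
    v∷firsts⊆I′ : ∀ {y} → y ∈ₗ v ∷ firsts t → y ∈ I′
    v∷firsts⊆I′ = ∈-replace-added ∘ setOf⁺
    cross : ∀ {x y} → x ∈ I → x ∉ A → y ∈ B → ¬ Adj G x y
    cross x∈I x∉A y∈B xy with setOf⁻ (v ∷ firsts t) y∈B
    ... | here refl = x∉A (P⊆A (subst (_∈ₗ Ps) (sym (I-neighbour-of-v x∈I (Adj-sym xy))) (last-∈ u a _)))
    ... | there y∈f = [ (λ { refl → u∉I x∈I }) , x∉A ∘ P⊆A ]′ (firsts-neighbour thread-P t y∈f (Adj-sym xy))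
    dom-near : ∀ {x} → x ∈ A ⊎ (∃ λ y → y ∈ I × y ∈ A × Adj G x y) → DominatedBy I′ x
    dom-near (inj₁ x∈A) with x∈p∪q⁻ (setOf Ps) ⁅ v ⁆ x∈A
    ... | inj₁ x∈P   = firsts-dominate thread-P t v∷firsts⊆I′ (setOf⁻ Ps x∈P)
    ... | inj₂ x∈⁅v⁆ = inj₁ (subst (_∈ I′) (sym (x∈⁅y⁆⇒x≡y v x∈⁅v⁆)) (v∷firsts⊆I′ (here refl)))
    dom-near (inj₂ (y , y∈I , y∈A , xy)) with x∈p∪q⁻ (setOf Ps) ⁅ v ⁆ y∈A
    ... | inj₂ y∈⁅v⁆ = ⊥-elim (v∉I (subst (_∈ I) (x∈⁅y⁆⇒x≡y v y∈⁅v⁆) y∈I))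
    ... | inj₁ y∈P with thread-neighbour thread-P (setOf⁻ Ps y∈P) (Adj-sym xy)
    ...   | inj₁ refl        = inj₂ (a , v∷firsts⊆I′ (there (here refl)) , Adj-u′ thread-P)
    ...   | inj₂ (inj₁ x∈P)  = firsts-dominate thread-P t v∷firsts⊆I′ x∈P
    ...   | inj₂ (inj₂ refl) = inj₁ (v∷firsts⊆I′ (here refl))
    open ≤-Reasoning
    count : ∣ B ∣ ≤ ∣ I ∩ A ∣
    count = begin
      ∣ B ∣                    ≤⟨ ∣setOf∣≤length (v ∷ firsts t) ⟩
      suc (length (firsts t))  ≡⟨ cong suc (length-firsts t) ⟩
      suc (suc k)              ≤⟨ count-triples-ends u thread-P t unique-P domI a∈I v′∈I ⟩
      ∣ I ∩ setOf Ps ∣         ≤⟨ p⊆q⇒∣p∣≤∣q∣ (λ x∈ → x∈p∩q⁺ (Product.map₂ (x∈p∪q⁺ ∘ inj₁) (x∈p∩q⁻ I _ x∈))) ⟩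
      ∣ I ∩ A ∣                ∎
    minI′ : MinIndepDominating G I′
    minI′ = replace-minIndepDominating minI
      (independent λ x∈ y∈ → end∷firsts-independent thread-P t u≢v v∉P unique-P (setOf⁻ _ x∈) (setOf⁻ _ y∈))
      cross dom-near count

lemma3p4 : ∀ {n} (G : Graph n) (u v : Fin n) (p q : ℕ)
    (P : Vec (Fin n) (3 * p)) (Q : Vec (Fin n) (3 * q)) →
    IsCycleUPVQ G u v (toList P) (toList Q) →
    (∀ w → w ∈ setOf (toList P) ∪ setOf (toList Q) → deg G w ≡ 2) →
    (I : Subset n) → MinIndepDominating G I →
    u′ u v (toList P) ∈ I →
    (v ∈ I →
      ∃ λ I′ → MinIndepDominating G I′ ×
        (I′ ─ setOf (toList Q) ≡ I ─ setOf (toList Q)) ×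
        DominatesOn (adjMinusP G u v (toList P)) (∁ (setOf (toList P)))
          (I′ ─ setOf (toList P)))
    ×
    (N G v ∩ I ≡ ⁅ v′ u v (toList P) ⁆ →
      ∃ λ I′ → MinIndepDominating G I′ ×
        u′ u v (toList P) ∈ I′ × v ∈ I′ ×
        (I′ ─ (setOf (toList P) ∪ ⁅ v ⁆) ≡ I ─ (setOf (toList P) ∪ ⁅ v ⁆)))
lemma3p4 G u v p q P Q cycle deg≡2 I minI u′∈I =
  part-i G C (triples q (toList Q) (length-toList Q)) minI u′∈I ,
  part-ii G C (triples p (toList P) (length-toList P)) minI u′∈I
  where
  C = toCycle G cycle deg≡2
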